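{- Let $n$ be a positive integer and let $\varphi \in \mathrm{FO}^2_n[<]$ be a unique position formula. Let $u \in \Sigma^\star$ and $i \in [1,|u|]$ with $(u,i) \models \varphi$. Then $i = r(u)$ for some ranker $r \in R_n^\star$, i.e. some $k$-ranker $r$ with $1\le k\le n$.
   Context: $\Sigma$ is a finite alphabet. A word $w=w_1\cdots w_{|w|}\in\Sigma^\star$ is identified with the structure with universe $\{1,\dots,|w|\}$, linear order $<$, and unary relations $Q_{\mathtt a}=\{i:w_i=\mathtt a\}$, $\mathtt a\in\Sigma$; $(w,i)$ denotes it with variable $x$ interpreted as $i$. $\mathrm{FO}^2_n[<]$ is the set of first-order formulas over this vocabulary using only variables $x,y$ (which may be requantified) with quantifier depth at most $n$. A formula $\varphi\in\mathrm{FO}^2[<]$ with free variable $x$ is a unique position formula if for every $w\in\Sigma^\star$ there is at most one $i\in[1,|w|]$ with $(w,i)\models\varphi$. A boundary position is a symbol $d_{\mathtt a}$ with $d\in\{\triangleright,\triangleleft\}$, $\mathtt a\in\Sigma$; $\triangleright_{\mathtt a}(w)=\min\{i\in[1,|w|]: w_i=\mathtt a\}$, $\triangleleft_{\mathtt a}(w)=\max\{i\in[1,|w|]: w_i=\mathtt a\}$, and relative to a position $q$: $\triangleright_{\mathtt a}(w,q)=\min\{i\in[q+1,|w|]: w_i=\mathtt a\}$, $\triangleleft_{\mathtt a}(w,q)=\max\{i\in[1,q-1]: w_i=\mathtt a\}$ (min/max of the empty set undefined). An $n$-ranker $r=(p_1,\dots,p_n)$ is a sequence of $n$ boundary positions with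 $r(w)=p_1(w)$ if $n=1$, $r(w)$ undefined if $(p_1,\dots,p_{n-1})(w)$ is undefined, and otherwise $r(w)=p_n(w,(p_1,\dots,p_{n-1})(w))$. $R_n^\star$ denotes the set of all $k$-rankers with $k\in[1,n]$. -}

module Defs where

open import Data.Nat using (ℕ; zero; suc; _⊔_)
open import Data.Fin using (Fin) renaming (_<_ to _<ᶠ_; _≤_ to _≤ᶠ_)
open import Data.List using (List; length; lookup)
open import Data.Product using (Σ; _×_)
open import Data.Sum using (_⊎_)
open import Data.Unit using (⊤)
open import Data.Empty using (⊥)
open import Relation.Nullary using (¬_)
open import Relation.Binary.PropositionalEquality using (_≡_; _≢_)

-- The alphabet Σ is Fin s (an arbitrary finite alphabet of size s).
-- Words are lists of letters; positions of w are Fin (length w)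
-- (0-indexed: Fin index j stands for the paper's position j+1).

Word : ℕ → Set
Word s = List (Fin s)

Pos : {s : ℕ} → Word s → Set
Pos w = Fin (length w)

letter : {s : ℕ} (w : Word s) → Pos w → Fin s
letter w i = lookup w i

data Var : Set where
  x y : Var

data Formula (s : ℕ) : Set where
  Q    : Fin s → Var → Formula s
  _≺_  : Var → Var → Formula s
  _≐_  : Var → Var → Formula s
  ¬'_  : Formula s → Formula s
  _∧'_ : Formula s → Formula s → Formula s
  _∨'_ : Formula s → Formula s → Formula s
  ∃'   : Var → Formula s → Formula s
  ∀'   : Var → Formula s → Formula s

qd : {s : ℕ} → Formula s → ℕ
qd (Q _ _)   = 0
qd (_ ≺ _)   = 0
qd (_ ≐ _)   = 0
qd (¬' φ)    = qd φ
qd (φ ∧' ψ)  = qd φ ⊔ qd ψ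
qd (φ ∨' ψ)  = qd φ ⊔ qd ψ
qd (∃' _ φ)  = suc (qd φ)
qd (∀' _ φ)  = suc (qd φ)

Free : {s : ℕ} → Var → Formula s → Set
Free v (Q _ u)   = v ≡ u
Free v (u ≺ u')  = v ≡ u ⊎ v ≡ u'
Free v (u ≐ u')  = v ≡ u ⊎ v ≡ u'
Free v (¬' φ)    = Free v φ
Free v (φ ∧' ψ)  = Free v φ ⊎ Free v ψ
Free v (φ ∨' ψ)  = Free v φ ⊎ Free v ψ
Free v (∃' u φ)  = v ≢ u × Free v φ
Free v (∀' u φ)  = v ≢ u × Free v φ

OnlyXFree : {s : ℕ} → Formula s → Set
OnlyXFree φ = ¬ Free y φ

Env : {s : ℕ} → Word s → Set
Env w = Var → Pos w

update : {s : ℕ} {w : Word s} → Env w → Var → Pos w → Env w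
update ρ x p x = p
update ρ x p y = ρ y
update ρ y p x = ρ x
update ρ y p y = p

Sat : {s : ℕ} (w : Word s) → Env w → Formula s → Set
Sat w ρ (Q a v)   = letter w (ρ v) ≡ a
Sat w ρ (u ≺ v)   = ρ u <ᶠ ρ v
Sat w ρ (u ≐ v)   = ρ u ≡ ρ v
Sat w ρ (¬' φ)    = ¬ Sat w ρ φ
Sat w ρ (φ ∧' ψ)  = Sat w ρ φ × Sat w ρ ψ
Sat w ρ (φ ∨' ψ)  = Sat w ρ φ ⊎ Sat w ρ ψ
Sat w ρ (∃' v φ)  = Σ (Pos w) λ p → Sat w (update {w = w} ρ v p) φ
Sat w ρ (∀' v φ)  = (p : Pos w) → Sat w (update {w = w} ρ v p) φ

-- (w,i) ⊨ φ : x interpreted as i.  For formulas with only x free the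
-- value of y is irrelevant; we fix it to i as well.
_,_⊨_ : {s : ℕ} (w : Word s) → Pos w → Formula s → Set
w , i ⊨ φ = Sat w (λ _ → i) φ

UniquePosition : {s : ℕ} → Formula s → Set
UniquePosition {s} φ =
  OnlyXFree φ ×
  ((w : Word s) (i j : Pos w) → w , i ⊨ φ → w , j ⊨ φ → i ≡ j)

data Dir : Set where
  ▷ ◁ : Dir

record Boundary (s : ℕ) : Set where
  constructor bd
  field
    dir : Dir
    sym : Fin s

AbsVal : {s : ℕ} (w : Word s) → Boundary s → Pos w → Set
AbsVal w (bd ▷ a) i = letter w i ≡ a × ((j : Pos w) → letter w j ≡ a → i ≤ᶠ j)
AbsVal w (bd ◁ a) i = letter w i ≡ a × ((j : Pos w) → letter w j ≡ a → j ≤ᶠ i)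

RelVal : {s : ℕ} (w : Word s) → Boundary s → Pos w → Pos w → Set
RelVal w (bd ▷ a) q i =
  q <ᶠ i × letter w i ≡ a × ((j : Pos w) → q <ᶠ j → letter w j ≡ a → i ≤ᶠ j)
RelVal w (bd ◁ a) q i =
  i <ᶠ q × letter w i ≡ a × ((j : Pos w) → j <ᶠ q → letter w j ≡ a → j ≤ᶠ i)

-- k-rankers (p₁,…,p_k), built by appending on the right; k ≥ 1
data Ranker (s : ℕ) : ℕ → Set where
  [_]  : Boundary s → Ranker s 1
  _▹_  : {k : ℕ} → Ranker s k → Boundary s → Ranker s (suc k)

RankerVal : {s k : ℕ} (w : Word s) → Ranker s k → Pos w → Set
RankerVal w [ p ]     i = AbsVal w p i
RankerVal w (r ▹ p)   i = Σ (Pos w) λ q → RankerVal w r q × RelVal w p q i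

module Submission where

-- Proof idea (an Ehrenfeucht–Fraïssé argument for FO²).  Call a position
-- m-definable if it is the value of some k-ranker with k ≤ m; this notion is
-- decidable.  Suppose (u,i) ⊨ φ but i is not n-definable.  Duplicate the
-- letter at i, obtaining a word with two adjacent copies of that position.
-- Every position of u that is not m-definable has a representative that is
-- (m+1)-definable, carries the same letter and lies in the same gap between
-- m-definable positions; definable positions are never the duplicated one.
-- With these representatives Duplicator wins the n-round FO² game between
-- (u,i) and either copy of i, so both copies satisfy φ, contradicting
-- uniqueness.

open import Defs
open import Data.Nat using (ℕ; zero; suc; _≤_; _<_; z≤n; s≤s)
open import Data.Nat.Properties
  using (≤-refl; ≤-reflexive; ≤-trans; <⇒≤; <-≤-trans; ≤-<-trans; n≤1+n;
         m⊔n≤o⇒m≤o; m⊔n≤o⇒n≤o; m≤n⇒m<n∨m≡n)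
open import Data.Fin using (Fin; zero; suc; toℕ; cast; pinch; punchIn)
  renaming (_<_ to _<ᶠ_; _≤_ to _≤ᶠ_)
open import Data.Fin.Properties
  using (toℕ-injective; toℕ-cast; cast-involutive; any?; all?; <-cmp; punchInᵢ≢i)
  renaming (_≟_ to _≟ᶠ_; _≤?_ to _≤?ᶠ_; _<?_ to _<?ᶠ_)
open import Data.List using (length; tabulate)
open import Data.List.Properties using (length-tabulate; lookup-tabulate)
open import Data.Product using (Σ; _×_; _,_)
open import Data.Sum using (_⊎_; inj₁; inj₂)
open import Data.Empty using (⊥; ⊥-elim)
open import Function using (_∘_)
open import Relation.Nullary using (¬_; Dec; yes; no)
open import Relation.Nullary.Decidable using (_×-dec_; _⊎-dec_; _→-dec_)
open import Relation.Unary using (Decidable)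
open import Relation.Binary.Definitions using (tri<; tri≈; tri>)
open import Relation.Binary.PropositionalEquality
open ≡-Reasoning

-- The order type of a pair of numbers; FO²[<] sees positions only
-- through it.
data Order : Set where
  less equal greater : Order

converse : Order → Order
converse less    = greater
converse equal   = equal
converse greater = less

cmp : ℕ → ℕ → Order
cmp zero    zero    = equal
cmp zero    (suc _) = less
cmp (suc _) zero    = greater
cmp (suc m) (suc n) = cmp m n

cmp-refl : ∀ m → cmp m m ≡ equal
cmp-refl zero    = refl
cmp-refl (suc m) = cmp-refl m

cmp-converse : ∀ m n → cmp n m ≡ converse (cmp m n)
cmp-converse zero    zero    = refl
cmp-converse zero    (suc n) = refl
cmp-converse (suc m) zero    = refl
cmp-converse (suc m) (suc n) = cmp-converse m n

cmp-< : ∀ {m n} → m < n → cmp m n ≡ less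
cmp-< {zero}  {suc n} _       = refl
cmp-< {suc m} {suc n} (s≤s p) = cmp-< p

cmp-> : ∀ {m n} → n < m → cmp m n ≡ greater
cmp-> {suc m} {zero}  _       = refl
cmp-> {suc m} {suc n} (s≤s p) = cmp-> p

less⇒< : ∀ m n → cmp m n ≡ less → m < n
less⇒< zero    (suc n) _ = s≤s z≤n
less⇒< (suc m) (suc n) e = s≤s (less⇒< m n e)
less⇒< zero    zero    ()
less⇒< (suc m) zero    ()

equal⇒≡ : ∀ m n → cmp m n ≡ equal → m ≡ n
equal⇒≡ zero    zero    _ = refl
equal⇒≡ (suc m) (suc n) e = cong suc (equal⇒≡ m n e)
equal⇒≡ zero    (suc n) ()
equal⇒≡ (suc m) zero    ()

transfer-< : ∀ {a b c d} → cmp a b ≡ cmp c d → c < d → a < b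
transfer-< {a} {b} e c<d = less⇒< a b (trans e (cmp-< c<d))

transfer-≤ : ∀ {a b c d} → cmp a b ≡ cmp c d → c ≤ d → a ≤ b
transfer-≤ {a} {b} {c} e c≤d with m≤n⇒m<n∨m≡n c≤d
... | inj₁ c<d  = <⇒≤ (transfer-< e c<d)
... | inj₂ refl = ≤-reflexive (equal⇒≡ a b (trans e (cmp-refl c)))

same-side-> : ∀ {p q r} → p < q → q ≤ r → cmp r p ≡ cmp q p
same-side-> p<q q≤r = trans (cmp-> (<-≤-trans p<q q≤r)) (sym (cmp-> p<q))

same-side-< : ∀ {p q r} → q < p → r ≤ q → cmp r p ≡ cmp q p
same-side-< q<p r≤q = trans (cmp-< (≤-<-trans r≤q q<p)) (sym (cmp-< q<p))

cmpᶠ : ∀ {N} → Fin N → Fin N → Order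
cmpᶠ p q = cmp (toℕ p) (toℕ q)

cmpᶠ-converse : ∀ {N} (p q : Fin N) → cmpᶠ q p ≡ converse (cmpᶠ p q)
cmpᶠ-converse p q = cmp-converse (toℕ p) (toℕ q)

both-equal : ∀ {N N'} (p : Fin N) (p' : Fin N') → cmpᶠ p p ≡ cmpᶠ p' p'
both-equal p p' = trans (cmp-refl (toℕ p)) (sym (cmp-refl (toℕ p')))

swap-order : ∀ {N N'} (p q : Fin N) (p' q' : Fin N') →
  cmpᶠ p q ≡ cmpᶠ p' q' → cmpᶠ q p ≡ cmpᶠ q' p'
swap-order p q p' q' e = begin
  cmpᶠ q p               ≡⟨ cmpᶠ-converse p q ⟩
  converse (cmpᶠ p q)    ≡⟨ cong converse e ⟩
  converse (cmpᶠ p' q')  ≡⟨ sym (cmpᶠ-converse p' q') ⟩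
  cmpᶠ q' p'             ∎

module _ {s : ℕ} where

  -- Game m L p L' p': Duplicator wins m more rounds of the FO² game on the
  -- words with letter functions L and L' when the pebble last moved lies
  -- on p and p'.  A round moves the other pebble; the answer must have the
  -- same order type relative to the pebble that stays.
  Game : ℕ → {N : ℕ} → (Fin N → Fin s) → Fin N →
         {N' : ℕ} → (Fin N' → Fin s) → Fin N' → Set
  Game zero          L p      L' p' = L p ≡ L' p'
  Game (suc m) {N} L p {N'} L' p' = L p ≡ L' p'
    × ((q : Fin N) → Σ (Fin N') λ q' → cmpᶠ q p ≡ cmpᶠ q' p' × Game m L q L' q')
    × ((q' : Fin N') → Σ (Fin N) λ q → cmpᶠ q p ≡ cmpᶠ q' p' × Game m L q L' q')

  Game-letter : ∀ m {N} {L : Fin N → Fin s} {p} {N'} {L' : Fin N' → Fin s} {p'} →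
    Game m L p L' p' → L p ≡ L' p'
  Game-letter zero    same           = same
  Game-letter (suc m) (same , _ , _) = same

  Game-weaken : ∀ m {N} {L : Fin N → Fin s} {p} {N'} {L' : Fin N' → Fin s} {p'} →
    Game (suc m) L p L' p' → Game m L p L' p'
  Game-weaken zero    (same , _ , _)         = same
  Game-weaken (suc m) (same , forth , back) =
    same , (λ q  → let (q' , o , g) = forth q  in q' , o , Game-weaken m g)
         , (λ q' → let (q  , o , g) = back  q' in q  , o , Game-weaken m g)

  Game-sym : ∀ m {N} {L : Fin N → Fin s} {p} {N'} {L' : Fin N' → Fin s} {p'} →
    Game m L p L' p' → Game m L' p' L p
  Game-sym zero    same                   = sym same
  Game-sym (suc m) (same , forth , back) =
    sym same , (λ q' → let (q  , o , g) = back  q' in q  , sym o , Game-sym m g)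
             , (λ q  → let (q' , o , g) = forth q  in q' , sym o , Game-sym m g)

  Game-cast : ∀ m {N} {L : Fin N → Fin s} {p : Fin N} {M M'}
    {f : Fin M → Fin s} {g : Fin M' → Fin s} (eq : M ≡ M') →
    (∀ t → g (cast eq t) ≡ f t) → ∀ {t} → Game m L p f t → Game m L p g (cast eq t)
  Game-cast zero eq g∘cast {t} same = trans same (sym (g∘cast t))
  Game-cast (suc m) {N} {L} {p} {M' = M'} {g = g} eq g∘cast {t} (same , forth , back) =
    trans same (sym (g∘cast t)) , forth' , back'
    where
    forth' : ∀ q → Σ (Fin M') λ q' → cmpᶠ q p ≡ cmpᶠ q' (cast eq t) × Game m L q g q'
    forth' q =
      let (q' , o , game) = forth q
      in cast eq q' , trans o (sym (cong₂ cmp (toℕ-cast eq q') (toℕ-cast eq t))) ,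
         Game-cast m eq g∘cast game
    back' : ∀ q' → Σ (Fin N) λ q → cmpᶠ q p ≡ cmpᶠ q' (cast eq t) × Game m L q g q'
    back' q' =
      let (q , o , game) = back (cast (sym eq) q')
      in q , trans o (cong₂ cmp (toℕ-cast (sym eq) q') (sym (toℕ-cast eq t))) ,
         subst (Game m L q g) (cast-involutive eq (sym eq) q') (Game-cast m eq g∘cast game)

  Config : ℕ → (w w' : Word s) → Env w → Env w' → Set
  Config m w w' ρ ρ' =
    ((v : Var) → Game m (letter w) (ρ v) (letter w') (ρ' v)) ×
    ((v v' : Var) → cmpᶠ (ρ v) (ρ v') ≡ cmpᶠ (ρ' v) (ρ' v'))

  config : ∀ m {w w'} {ρ : Env w} {ρ' : Env w'} →
    Game m (letter w) (ρ x) (letter w') (ρ' x) →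
    Game m (letter w) (ρ y) (letter w') (ρ' y) →
    cmpᶠ (ρ x) (ρ y) ≡ cmpᶠ (ρ' x) (ρ' y) → Config m w w' ρ ρ'
  config m {ρ = ρ} {ρ'} game-x game-y order-xy = games , orders
    where
    games : (v : Var) → Game m _ (ρ v) _ (ρ' v)
    games x = game-x
    games y = game-y
    orders : (v v' : Var) → cmpᶠ (ρ v) (ρ v') ≡ cmpᶠ (ρ' v) (ρ' v')
    orders x x = both-equal (ρ x) (ρ' x)
    orders x y = order-xy
    orders y x = swap-order (ρ x) (ρ y) (ρ' x) (ρ' y) order-xy
    orders y y = both-equal (ρ y) (ρ' y)

  Config-sym : ∀ m {w w'} {ρ : Env w} {ρ' : Env w'} →
    Config m w w' ρ ρ' → Config m w' w ρ' ρ
  Config-sym m (games , orders) = (λ v → Game-sym m (games v)) , (λ v v' → sym (orders v v'))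

  other : Var → Var
  other x = y
  other y = x

  Config-move : ∀ m {w w'} {ρ : Env w} {ρ' : Env w'} → Config (suc m) w w' ρ ρ' →
    (v : Var) (q : Pos w) (q' : Pos w') →
    cmpᶠ q (ρ (other v)) ≡ cmpᶠ q' (ρ' (other v)) →
    Game m (letter w) q (letter w') q' →
    Config m w w' (update {w = w} ρ v q) (update {w = w'} ρ' v q')
  Config-move m {w} {w'} {ρ} {ρ'} (games , _) x q q' order game =
    config m {w} {w'} {update {w = w} ρ x q} {update {w = w'} ρ' x q'}
      game (Game-weaken m (games y)) order
  Config-move m {w} {w'} {ρ} {ρ'} (games , _) y q q' order game =
    config m {w} {w'} {update {w = w} ρ y q} {update {w = w'} ρ' y q'}
      (Game-weaken m (games x)) game (swap-order q (ρ x) q' (ρ' x) order)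

  game-sound : (φ : Formula s) (m : ℕ) {w w' : Word s} {ρ : Env w} {ρ' : Env w'} →
    qd φ ≤ m → Config m w w' ρ ρ' → Sat w ρ φ → Sat w' ρ' φ
  game-sound (Q a v)  m _ (games , _) sat = trans (sym (Game-letter m (games v))) sat
  game-sound (v ≺ v') m _ (_ , orders) sat = transfer-< (sym (orders v v')) sat
  game-sound (v ≐ v') m {ρ = ρ} {ρ'} _ (_ , orders) sat =
    toℕ-injective (equal⇒≡ _ _ (begin
      cmpᶠ (ρ' v) (ρ' v') ≡⟨ sym (orders v v') ⟩
      cmpᶠ (ρ v) (ρ v')   ≡⟨ cong (λ z → cmpᶠ z (ρ v')) sat ⟩
      cmpᶠ (ρ v') (ρ v')  ≡⟨ cmp-refl (toℕ (ρ v')) ⟩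
      equal               ∎))
  game-sound (¬' φ) m {w} {w'} le c sat sat' =
    sat (game-sound φ m {w'} {w} le (Config-sym m {w} {w'} c) sat')
  game-sound (φ ∧' ψ) m le c (sat-φ , sat-ψ) =
    game-sound φ m (m⊔n≤o⇒m≤o (qd φ) (qd ψ) le) c sat-φ ,
    game-sound ψ m (m⊔n≤o⇒n≤o (qd φ) (qd ψ) le) c sat-ψ
  game-sound (φ ∨' ψ) m le c (inj₁ sat) = inj₁ (game-sound φ m (m⊔n≤o⇒m≤o (qd φ) (qd ψ) le) c sat)
  game-sound (φ ∨' ψ) m le c (inj₂ sat) = inj₂ (game-sound ψ m (m⊔n≤o⇒n≤o (qd φ) (qd ψ) le) c sat)
  game-sound (∃' v φ) (suc m) {w} {w'} (s≤s le) c (q , sat) =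
    let (games , _) = c
        (_ , forth , _) = games (other v)
        (q' , order , game) = forth q
    in q' , game-sound φ m {w} {w'} le (Config-move m {w} {w'} c v q q' order game) sat
  game-sound (∀' v φ) (suc m) {w} {w'} (s≤s le) c sat q' =
    let (games , _) = c
        (_ , _ , back) = games (other v)
        (q , order , game) = back q'
    in game-sound φ m {w} {w'} le (Config-move m {w} {w'} c v q q' order game) (sat q)

greatest : ∀ {N} {P : Fin N → Set} → Decidable P → (j₀ : Fin N) → P j₀ →
  Σ (Fin N) λ j → P j × (∀ k → P k → k ≤ᶠ j)
greatest {suc N} P? j₀ pj₀ with any? (λ k → P? (suc k))
greatest {suc N} P? j₀ pj₀ | yes (k , pk) =
  let (j , pj , above) = greatest (λ k → P? (suc k)) k pk
  in suc j , pj , λ { zero _ → z≤n ; (suc k) pk → s≤s (above k pk) }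
greatest {suc N} P? zero    pz | no none =
  zero , pz , λ { zero _ → z≤n ; (suc k) pk → ⊥-elim (none (k , pk)) }
greatest {suc N} P? (suc j) pj | no none = ⊥-elim (none (j , pj))

least : ∀ {N} {P : Fin N → Set} → Decidable P → (j₀ : Fin N) → P j₀ →
  Σ (Fin N) λ j → P j × (∀ k → P k → j ≤ᶠ k)
least {suc N} P? j₀ pj₀ with P? zero
least {suc N} P? j₀      pj₀ | yes pz = zero , pz , λ _ _ → z≤n
least {suc N} P? zero    pz  | no ¬pz = ⊥-elim (¬pz pz)
least {suc N} P? (suc j) pj  | no ¬pz =
  let (k , pk , below) = least (λ k → P? (suc k)) j pj
  in suc k , pk , λ { zero pz → ⊥-elim (¬pz pz) ; (suc l) pl → s≤s (below l pl) }

boundary? : ∀ {s} {P : Boundary s → Set} → (∀ b → Dec (P b)) → Dec (Σ (Boundary s) P)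
boundary? P? with any? (λ a → P? (bd ▷ a)) | any? (λ a → P? (bd ◁ a))
... | yes (a , pa) | _            = yes (bd ▷ a , pa)
... | no _         | yes (a , pa) = yes (bd ◁ a , pa)
... | no none▷     | no none◁     =
  no λ { (bd ▷ a , pa) → none▷ (a , pa) ; (bd ◁ a , pa) → none◁ (a , pa) }

module Definability {s : ℕ} (u : Word s) where

  -- Definable m q: q is the value on u of a k-ranker with 1 ≤ k ≤ m,
  -- unfolded as: a 1-ranker value, one boundary step from an
  -- (m-1)-definable position, or already (m-1)-definable.
  Definable : ℕ → Pos u → Set
  Definable zero    q = ⊥
  Definable (suc m) q =
    Σ (Boundary s) (λ b → AbsVal u b q) ⊎
    (Σ (Pos u) λ h → Definable m h × Σ (Boundary s) λ b → RelVal u b h q) ⊎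
    Definable m q

  definable-suc : ∀ {m q} → Definable m q → Definable (suc m) q
  definable-suc = inj₂ ∘ inj₂

  RankerDefinable : ℕ → Pos u → Set
  RankerDefinable m q = Σ ℕ λ k → 1 ≤ k × k ≤ m × Σ (Ranker s k) λ r → RankerVal u r q

  definable⇒ranker : ∀ m q → Definable m q → RankerDefinable m q
  definable⇒ranker (suc m) q (inj₁ (b , val)) = 1 , ≤-refl , s≤s z≤n , [ b ] , val
  definable⇒ranker (suc m) q (inj₂ (inj₁ (h , def-h , b , val)))
    with definable⇒ranker m h def-h
  ... | k , _ , k≤m , r , val-h = suc k , s≤s z≤n , s≤s k≤m , r ▹ b , h , val-h , val
  definable⇒ranker (suc m) q (inj₂ (inj₂ def)) with definable⇒ranker m q def
  ... | k , 1≤k , k≤m , r , val = k , 1≤k , ≤-trans k≤m (n≤1+n m) , r , val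

  absVal? : ∀ b q → Dec (AbsVal u b q)
  absVal? (bd ▷ a) q = (letter u q ≟ᶠ a) ×-dec all? (λ j → (letter u j ≟ᶠ a) →-dec (q ≤?ᶠ j))
  absVal? (bd ◁ a) q = (letter u q ≟ᶠ a) ×-dec all? (λ j → (letter u j ≟ᶠ a) →-dec (j ≤?ᶠ q))

  relVal? : ∀ b h q → Dec (RelVal u b h q)
  relVal? (bd ▷ a) h q = (h <?ᶠ q) ×-dec ((letter u q ≟ᶠ a) ×-dec
    all? (λ j → (h <?ᶠ j) →-dec ((letter u j ≟ᶠ a) →-dec (q ≤?ᶠ j))))
  relVal? (bd ◁ a) h q = (q <?ᶠ h) ×-dec ((letter u q ≟ᶠ a) ×-dec
    all? (λ j → (j <?ᶠ h) →-dec ((letter u j ≟ᶠ a) →-dec (j ≤?ᶠ q))))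

  definable? : ∀ m q → Dec (Definable m q)
  definable? zero    q = no λ ()
  definable? (suc m) q =
    boundary? (λ b → absVal? b q) ⊎-dec
    (any? (λ h → definable? m h ×-dec boundary? (λ b → relVal? b h q)) ⊎-dec
     definable? m q)

  SameGap : ℕ → Pos u → Pos u → Set
  SameGap m q r = ∀ v → Definable m v → cmpᶠ q v ≡ cmpᶠ r v

  -- An (m+1)-definable stand-in for q that FO² with m-definable
  -- landmarks cannot tell apart from q.
  record Representative (m : ℕ) (q : Pos u) : Set where
    constructor representative
    field
      pos         : Pos u
      same-letter : letter u pos ≡ letter u q
      definable   : Definable (suc m) pos
      same-gap    : SameGap m q pos
  open Representative public

  itself : ∀ {m q} → Definable m q → Representative m q
  itself def = representative _ refl (definable-suc def) (λ _ _ → refl)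

  gap-right : ∀ {m q r} → ¬ Definable m q → q ≤ᶠ r →
    (∀ v → Definable m v → q <ᶠ v → r <ᶠ v) → SameGap m q r
  gap-right {q = q} ¬def q≤r above v def with <-cmp v q
  ... | tri< v<q _ _ = sym (same-side-> v<q q≤r)
  ... | tri≈ _ refl _ = ⊥-elim (¬def def)
  ... | tri> _ _ q<v = trans (cmp-< q<v) (sym (cmp-< (above v def q<v)))

  gap-left : ∀ {m q r} → ¬ Definable m q → r ≤ᶠ q →
    (∀ v → Definable m v → v <ᶠ q → v <ᶠ r) → SameGap m q r
  gap-left {q = q} ¬def r≤q below v def with <-cmp v q
  ... | tri< v<q _ _ = trans (cmp-> v<q) (sym (cmp-> (below v def v<q)))
  ... | tri≈ _ refl _ = ⊥-elim (¬def def)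
  ... | tri> _ _ q<v = sym (same-side-< q<v r≤q)

  -- A representative at or to the right of q: the last occurrence of
  -- q's letter before the next m-definable position (or in the whole word).
  pick-right : ∀ m q → Σ (Representative m q) λ R → q ≤ᶠ pos R
  pick-right m q with definable? m q
  ... | yes def = itself def , ≤-refl
  ... | no ¬def with any? (λ h → definable? m h ×-dec (q <?ᶠ h))
  ... | yes (h₀ , above₀) =
    let (h , (def-h , q<h) , h-least) = least (λ h → definable? m h ×-dec (q <?ᶠ h)) h₀ above₀
        (r , (same , r<h) , r-last) =
          greatest (λ j → (letter u j ≟ᶠ letter u q) ×-dec (j <?ᶠ h)) q (refl , q<h)
        q≤r = r-last q (refl , q<h)
    in representative r same
         (inj₂ (inj₁ (h , def-h , bd ◁ (letter u q) , r<h , same ,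
                      λ j j<h same-j → r-last j (same-j , j<h))))
         (gap-right ¬def q≤r λ v def-v q<v → <-≤-trans r<h (h-least v (def-v , q<v))) ,
       q≤r
  ... | no none-above =
    let (r , same , r-last) = greatest (λ j → letter u j ≟ᶠ letter u q) q refl
        q≤r = r-last q refl
    in representative r same (inj₁ (bd ◁ (letter u q) , same , r-last))
         (gap-right ¬def q≤r λ v def-v q<v → ⊥-elim (none-above (v , def-v , q<v))) ,
       q≤r

  -- Mirror image: the first occurrence of q's letter after the previous
  -- m-definable position (or in the whole word).
  pick-left : ∀ m q → Σ (Representative m q) λ R → pos R ≤ᶠ q
  pick-left m q with definable? m q
  ... | yes def = itself def , ≤-refl
  ... | no ¬def with any? (λ h → definable? m h ×-dec (h <?ᶠ q))
  ... | yes (h₀ , below₀) =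
    let (h , (def-h , h<q) , h-greatest) = greatest (λ h → definable? m h ×-dec (h <?ᶠ q)) h₀ below₀
        (r , (same , h<r) , r-first) =
          least (λ j → (letter u j ≟ᶠ letter u q) ×-dec (h <?ᶠ j)) q (refl , h<q)
        r≤q = r-first q (refl , h<q)
    in representative r same
         (inj₂ (inj₁ (h , def-h , bd ▷ (letter u q) , h<r , same ,
                      λ j h<j same-j → r-first j (same-j , h<j))))
         (gap-left ¬def r≤q λ v def-v v<q → ≤-<-trans (h-greatest v (def-v , v<q)) h<r) ,
       r≤q
  ... | no none-below =
    let (r , same , r-first) = least (λ j → letter u j ≟ᶠ letter u q) q refl
        r≤q = r-first q refl
    in representative r same (inj₁ (bd ▷ (letter u q) , same , r-first))
         (gap-left ¬def r≤q λ v def-v v<q → ⊥-elim (none-below (v , def-v , v<q))) ,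
       r≤q

-- pinch i : Fin (suc n) → Fin n merges i and i+1; punchIn (suc i) embeds
-- Fin n into Fin (suc n) skipping i+1.  Away from i both preserve order.
pinch-punchIn : ∀ {n} (i v : Fin n) → pinch i (punchIn (suc i) v) ≡ v
pinch-punchIn {suc n} zero    zero    = refl
pinch-punchIn {suc n} zero    (suc v) = refl
pinch-punchIn {suc n} (suc i) zero    = refl
pinch-punchIn {suc n} (suc i) (suc v) = cong suc (pinch-punchIn i v)

-- i+1 is merged into i as well: it is the second copy of i.
pinch-suc : ∀ {n} (i : Fin n) → pinch i (suc i) ≡ i
pinch-suc {suc n} zero    = refl
pinch-suc {suc n} (suc i) = cong suc (pinch-suc i)

cmp-punchIn : ∀ {n} (i : Fin n) (t : Fin (suc n)) (v : Fin n) → v ≢ i →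
  cmpᶠ t (punchIn (suc i) v) ≡ cmpᶠ (pinch i t) v
cmp-punchIn {suc n} zero    t             zero    v≢i = ⊥-elim (v≢i refl)
cmp-punchIn {suc n} zero    zero          (suc v) _   = refl
cmp-punchIn {suc n} zero    (suc zero)    (suc v) _   = refl
cmp-punchIn {suc n} zero    (suc (suc t)) (suc v) _   = refl
cmp-punchIn {suc n} (suc i) zero          zero    _   = refl
cmp-punchIn {suc n} (suc i) (suc t)       zero    _   = refl
cmp-punchIn {suc n} (suc i) zero          (suc v) _   = refl
cmp-punchIn {suc n} (suc i) (suc t)       (suc v) v≢i = cmp-punchIn i t v (v≢i ∘ cong suc)

-- The word obtained from u by doubling its i-th letter, with positions
-- Fin (suc N); merge sends both copies of i back to i, embed is a section
-- of merge that picks the first copy.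
module Duplicate {s : ℕ} (u : Word s) (i : Pos u) where
  open Definability u

  N : ℕ
  N = length u

  merge : Fin (suc N) → Pos u
  merge = pinch i

  embed : Pos u → Fin (suc N)
  embed = punchIn (suc i)

  doubled : Fin (suc N) → Fin s
  doubled t = letter u (merge t)

  embed-above : ∀ {r} t → r ≢ i → merge t ≤ᶠ r → t ≤ᶠ embed r
  embed-above {r} t r≢i = transfer-≤ (cmp-punchIn i t r r≢i)

  embed-below : ∀ {r} t → r ≢ i → r ≤ᶠ merge t → embed r ≤ᶠ t
  embed-below {r} t r≢i = transfer-≤ (swap-order t (embed r) (merge t) r (cmp-punchIn i t r r≢i))

  Similar : ℕ → Pos u → Fin (suc N) → Set
  Similar m p p' = letter u p ≡ doubled p' × SameGap m p (merge p')

  similar-merge : ∀ {m p'} → merge p' ≡ i → Similar m i p'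
  similar-merge merged = cong (letter u) (sym merged) , λ v _ → cong (λ z → cmpᶠ z v) (sym merged)

  similar-embed : ∀ {m q} (R : Representative m q) → Similar m q (embed (pos R))
  similar-embed R rewrite pinch-punchIn i (pos R) = sym (same-letter R) , same-gap R

  similar-rep : ∀ {m q'} (R : Representative m (merge q')) → Similar m (pos R) q'
  similar-rep R = same-letter R , λ v def → sym (same-gap R v def)

  -- Duplicator's strategy: answer a move by the representative on the
  -- same side, transported to the other word.
  similar⇒game : ∀ m {p p'} → ¬ Definable m i → Similar m p p' →
    Game m (letter u) p doubled p'
  similar⇒game zero    _    (same , _)   = same
  similar⇒game (suc m) {p} {p'} ¬def-i (same , gap) = same , forth , back
    where
    ¬def-i' : ¬ Definable m i
    ¬def-i' = ¬def-i ∘ definable-suc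

    avoids-i : ∀ {r} → Definable (suc m) r → r ≢ i
    avoids-i def refl = ¬def-i def

    embed-side : ∀ {r} → Definable (suc m) r → cmpᶠ (embed r) p' ≡ cmpᶠ r p
    embed-side {r} def = begin
      cmpᶠ (embed r) p'             ≡⟨ cmpᶠ-converse p' (embed r) ⟩
      converse (cmpᶠ p' (embed r))  ≡⟨ cong converse (cmp-punchIn i p' r (avoids-i def)) ⟩
      converse (cmpᶠ (merge p') r)  ≡⟨ cong converse (sym (gap r def)) ⟩
      converse (cmpᶠ p r)           ≡⟨ sym (cmpᶠ-converse p r) ⟩
      cmpᶠ r p                      ∎

    stay : Similar m p p'
    stay = same , λ v def → gap v (definable-suc def)

    answer-forth : ∀ {q} (R : Representative m q) → cmpᶠ (pos R) p ≡ cmpᶠ q p →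
      Σ (Fin (suc N)) λ q' → cmpᶠ q p ≡ cmpᶠ q' p' × Game m (letter u) q doubled q'
    answer-forth R side =
      embed (pos R) , trans (sym side) (sym (embed-side (definable R))) ,
      similar⇒game m ¬def-i' (similar-embed R)

    forth : (q : Pos u) →
      Σ (Fin (suc N)) λ q' → cmpᶠ q p ≡ cmpᶠ q' p' × Game m (letter u) q doubled q'
    forth q with <-cmp q p
    ... | tri≈ _ refl _ = p' , both-equal p p' , similar⇒game m ¬def-i' stay
    ... | tri< q<p _ _ = let (R , r≤q) = pick-left m q in answer-forth R (same-side-< q<p r≤q)
    ... | tri> _ _ p<q = let (R , q≤r) = pick-right m q in answer-forth R (same-side-> p<q q≤r)

    answer-back : ∀ {q'} (R : Representative m (merge q')) →
      cmpᶠ (embed (pos R)) p' ≡ cmpᶠ q' p' →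
      Σ (Pos u) λ q → cmpᶠ q p ≡ cmpᶠ q' p' × Game m (letter u) q doubled q'
    answer-back R side =
      pos R , trans (sym (embed-side (definable R))) side ,
      similar⇒game m ¬def-i' (similar-rep R)

    back : (q' : Fin (suc N)) →
      Σ (Pos u) λ q → cmpᶠ q p ≡ cmpᶠ q' p' × Game m (letter u) q doubled q'
    back q' with <-cmp q' p'
    ... | tri≈ _ refl _ = p , both-equal p p' , similar⇒game m ¬def-i' stay
    ... | tri< q'<p' _ _ =
      let (R , r≤t) = pick-left m (merge q')
      in answer-back R (same-side-< q'<p' (embed-below q' (avoids-i (definable R)) r≤t))
    ... | tri> _ _ p'<q' =
      let (R , t≤r) = pick-right m (merge q')
      in answer-back R (same-side-> p'<q' (embed-above q' (avoids-i (definable R)) t≤r))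

  doubledWord : Word s
  doubledWord = tabulate doubled

  toDoubled : Fin (suc N) → Pos doubledWord
  toDoubled = cast (sym (length-tabulate doubled))

  toDoubled-injective : ∀ {t t'} → toDoubled t ≡ toDoubled t' → t ≡ t'
  toDoubled-injective {t} {t'} e = toℕ-injective (begin
    toℕ t              ≡⟨ sym (toℕ-cast _ t) ⟩
    toℕ (toDoubled t)  ≡⟨ cong toℕ e ⟩
    toℕ (toDoubled t') ≡⟨ toℕ-cast _ t' ⟩
    toℕ t'             ∎)

  copies-satisfy : ∀ n (φ : Formula s) → qd φ ≤ n → ¬ Definable n i →
    u , i ⊨ φ → ∀ t → merge t ≡ i → doubledWord , toDoubled t ⊨ φ
  copies-satisfy n φ qd≤n ¬def-i sat t merged =
    game-sound φ n qd≤n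
      (config n {u} {doubledWord} {λ _ → i} {λ _ → toDoubled t} game game (both-equal i (toDoubled t)))
      sat
    where
    game : Game n (letter u) i (letter doubledWord) (toDoubled t)
    game = Game-cast n (sym (length-tabulate doubled)) (lookup-tabulate doubled)
             (similar⇒game n ¬def-i (similar-merge merged))

lemma3p11 : {s : ℕ} (n : ℕ) → 1 ≤ n →
    (φ : Formula s) → qd φ ≤ n → UniquePosition φ →
    (u : Word s) (i : Pos u) → u , i ⊨ φ →
    Σ ℕ λ k → 1 ≤ k × k ≤ n × Σ (Ranker s k) λ r → RankerVal u r i
lemma3p11 n _ φ qd≤n (_ , unique) u i sat with Definability.definable? u n i
... | yes def = Definability.definable⇒ranker u n i def
... | no ¬def = ⊥-elim (punchInᵢ≢i (suc i) i (toDoubled-injective copies-equal))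
  where
  open Duplicate u i
  -- the two copies of i are embed i and suc i; both satisfy φ
  copies-equal : toDoubled (embed i) ≡ toDoubled (suc i)
  copies-equal = unique doubledWord (toDoubled (embed i)) (toDoubled (suc i))
    (copies-satisfy n φ qd≤n ¬def sat (embed i) (pinch-punchIn i i))
    (copies-satisfy n φ qd≤n ¬def sat (suc i) (pinch-suc i))
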